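{- Let $V$ be a digraph on $\mathcal N=\{1,\dots,N\}$ with real arc weights. Let $F\in\tilde{\mathcal F}^n(V)$ and $G\in\tilde{\mathcal F}^m(V)$ with $m\ge n$, and let $\mathcal D\subseteq\mathcal N$ be such that the $\mathcal D$-exchange $P$ of $F$ by $G$ and the $\mathcal D$-exchange $Q$ of $G$ by $F$ are both forests. Then: a) if $|\mathcal D\cap\mathcal W^F|-|\mathcal D\cap\mathcal W^G|=l\ge0$, then $P\in\tilde{\mathcal F}^{n-l}(V)$ and $Q\in\tilde{\mathcal F}^{m+l}(V)$; b) if $|\mathcal D\cap\mathcal W^G|-|\mathcal D\cap\mathcal W^F|=l\ge m-n$, then $P\in\tilde{\mathcal F}^{n+l}(V)$ and $Q\in\tilde{\mathcal F}^{m-l}(V)$.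
   Context: $V$ is a directed graph with vertex set $\mathcal N$, arc set $\mathcal A V\subseteq\mathcal N^2$, and real weights $v_{ij}$ on arcs $(i,j)$. A forest is a digraph without directed circuits (loops count as circuits) in which every vertex has outdegree $0$ or $1$; its trees are its weakly connected components; the root of a tree is its unique vertex of outdegree $0$; $\mathcal W^F$ is the set of roots of the forest $F$. $\mathcal F^k(V)$ is the set of spanning subgraphs of $V$ that are forests with exactly $k$ trees; $\Sigma^F=\sum_{(i,j)\in\mathcal A F}v_{ij}$; $\varphi_k=\min_{F\in\mathcal F^k(V)}\Sigma^F$ ($+\infty$ if empty); $\tilde{\mathcal F}^k(V)=\{F\in\mathcal F^k(V):\Sigma^F=\varphi_k\}$. For digraphs $F,G$ on $\mathcal N$ and $\mathcal D\subseteq\mathcal N$, the $\mathcal D$-exchange of $F$ by $G$ is the digraph on $\mathcal N$ whose arcs are the arcs of $F$ with origin outside $\mathcal D$ together with the arcs of $G$ with origin in $\mathcal D$. -}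

module Defs where

open import Level using (Level; _⊔_) renaming (suc to lsuc)
open import Data.Nat using (ℕ; zero; _+_)
import Data.Nat as Nat
open import Data.Fin using (Fin; zero; suc)
open import Data.Bool using (Bool; true; false; if_then_else_; _∧_)
open import Data.Product using (_×_; Σ-syntax)
open import Data.Sum using (_⊎_)
open import Relation.Nullary using (¬_)
open import Relation.Binary.PropositionalEquality using (_≡_)
open import Relation.Binary.Core using (Rel)
open import Relation.Binary.Structures using (IsTotalOrder)
open import Algebra.Bundles using (AbelianGroup)

-- Weights: a totally ordered abelian group (ℝ with + and ≤ is one).

record OrderedAbelianGroup (c ℓ₁ ℓ₂ : Level) : Set (lsuc (c ⊔ ℓ₁ ⊔ ℓ₂)) where
  field
    abelianGroup : AbelianGroup c ℓ₁
  open AbelianGroup abelianGroup public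
  field
    _≤_          : Rel Carrier ℓ₂
    isTotalOrder : IsTotalOrder _≈_ _≤_
    ∙-monoˡ-≤    : ∀ {x y} z → x ≤ y → (x ∙ z) ≤ (y ∙ z)

sumFin : ∀ {a} {A : Set a} (_+'_ : A → A → A) (0' : A) (n : ℕ) → (Fin n → A) → A
sumFin _+'_ 0' zero    f = 0'
sumFin _+'_ 0' (Nat.suc n) f = f zero +' sumFin _+'_ 0' n (λ i → f (suc i))

count : (n : ℕ) → (Fin n → Bool) → ℕ
count zero    p = 0
count (Nat.suc n) p = (if p zero then 1 else 0) + count n (λ i → p (suc i))

Digraph : ℕ → Set
Digraph N = Fin N → Fin N → Bool

Subset : ℕ → Set
Subset N = Fin N → Bool

module _ {N : ℕ} where

  _⊆ᴬ_ : Digraph N → Digraph N → Set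
  F ⊆ᴬ V = ∀ i j → F i j ≡ true → V i j ≡ true

  outdeg : Digraph N → Fin N → ℕ
  outdeg F i = count N (F i)

  data Walk (F : Digraph N) : Fin N → Fin N → Set where
    arc  : ∀ {i j} → F i j ≡ true → Walk F i j
    _∷_  : ∀ {i j k} → F i j ≡ true → Walk F j k → Walk F i k

  -- no directed circuit (loops count as circuits): no closed nonempty walk
  Acyclic : Digraph N → Set
  Acyclic F = ∀ i → ¬ Walk F i i

  IsForest : Digraph N → Set
  IsForest F = Acyclic F × (∀ i → outdeg F i ≡ 0 ⊎ outdeg F i ≡ 1)

  isRoot : Digraph N → Fin N → Bool
  isRoot F i with outdeg F i
  ... | zero    = true
  ... | Nat.suc _ = false

  -- number of trees of a forest = number of roots (each tree has a unique root)
  numTrees : Digraph N → ℕ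
  numTrees F = count N (isRoot F)

  -- |D ∩ W^F|
  rootsIn : Subset N → Digraph N → ℕ
  rootsIn D F = count N (λ i → D i ∧ isRoot F i)

  exchange : Digraph N → Digraph N → Subset N → Digraph N
  exchange F G D i j = if D i then G i j else F i j

  InForests : Digraph N → ℕ → Digraph N → Set
  InForests V k F = F ⊆ᴬ V × IsForest F × numTrees F ≡ k

module _ {c ℓ₁ ℓ₂} (W : OrderedAbelianGroup c ℓ₁ ℓ₂) {N : ℕ} where
  open OrderedAbelianGroup W

  weight : (Fin N → Fin N → Carrier) → Digraph N → Carrier
  weight v F = sumFin _∙_ ε N (λ i → sumFin _∙_ ε N (λ j → if F i j then v i j else ε))

  -- F ∈ 𝓕̃^k(V): F ∈ 𝓕^k(V) and Σ^F = φ_k, i.e. Σ^F ≤ Σ^G for all G ∈ 𝓕^k(V)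
  InMinForests : Digraph N → (Fin N → Fin N → Carrier) → ℕ → Digraph N → Set ℓ₂
  InMinForests V v k F =
    InForests V k F × (∀ G → InForests V k G → weight v F ≤ weight v G)

{-# OPTIONS --safe #-}
module Submission where

-- If a forest R has fewer trees than a forest Q, some tree of Q contains no root of R; exchanging
-- the arcs leaving the vertices of that tree gives two forests, one with a tree more and one with
-- a tree fewer, whose weights have the same sum. Iterating, two forests with a ≤ n ≤ m ≤ b trees
-- and a + b = n + m can be rebalanced to n and m trees at no cost, so φ n + φ m ≤ φ a + φ b.
-- The D-exchanges P and Q of F and G have n ∓ l and m ± l trees and Σ^P + Σ^Q = Σ^F + Σ^G, so this
-- convexity makes each of them optimal for its number of trees.

open import Defs
open import Data.Bool using (Bool; true; false; if_then_else_; _∧_; not)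
open import Data.Bool.Properties using (¬-not; ∧-zeroʳ)
open import Data.Empty using (⊥; ⊥-elim)
open import Data.Fin as Fin using (Fin; zero; suc)
open import Data.Fin.Properties as Finₚ using (_≟_; pigeonhole; 0≢1+n)
open import Data.Nat using (ℕ; zero; suc; _+_; _∸_; _≤_; _<_; z≤n; s≤s; s≤s⁻¹; s<s⁻¹)
open import Data.Nat.Properties
  using ( +-0-commutativeMonoid; +-commutativeSemigroup; +-comm; +-assoc; +-suc; +-cancelˡ-≡; +-cancelʳ-≡
        ; +-cancelʳ-≤; ≤-refl; ≤-trans; ≤-<-trans; <⇒≢; <⇒≱; n<1+n
        ; m≤m+n; m≤n+m; m+n≤o⇒n≤o; m+n∸n≡m; m≤n+m∸n; +-monoʳ-≤; suc-injective; m≤n⇒∃[o]m+o≡n)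
open import Data.Product as Product using (_×_; _,_; proj₁; proj₂; ∃; ∃₂; swap)
open import Data.Sum as Sum using (_⊎_; inj₁; inj₂)
import Data.Vec.Functional as Vector
open import Function using (_∘_; id)
open import Relation.Binary.Construct.Closure.ReflexiveTransitive using (Star; ε; _◅_)
open import Relation.Binary.PropositionalEquality
  using (_≡_; refl; sym; trans; cong; cong₂; subst; module ≡-Reasoning)
open import Relation.Binary.Structures using (IsTotalOrder)
open import Relation.Nullary using (does; yes; no)
open import Relation.Nullary.Decidable using (dec-true)
import Algebra.Properties.CommutativeMonoid.Sum as CommutativeMonoidSum
import Algebra.Properties.Group as GroupProperties
open import Algebra.Properties.CommutativeSemigroup +-commutativeSemigroup
  using () renaming (interchange to +-interchange)

[_] : Bool → ℕ
[ b ] = if b then 1 else 0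

module ℕΣ = CommutativeMonoidSum +-0-commutativeMonoid

count≡sum : ∀ n (p : Fin n → Bool) → count n p ≡ ℕΣ.sum (λ i → [ p i ])
count≡sum zero    p = refl
count≡sum (suc n) p = cong ([ p zero ] +_) (count≡sum n (p ∘ suc))

count-cong : ∀ n {p q : Fin n → Bool} → (∀ i → p i ≡ q i) → count n p ≡ count n q
count-cong zero    p≗q = refl
count-cong (suc n) p≗q = cong₂ (λ b c → [ b ] + c) (p≗q zero) (count-cong n (p≗q ∘ suc))

all-false⇒count≡0 : ∀ n {p : Fin n → Bool} → (∀ i → p i ≡ false) → count n p ≡ 0
all-false⇒count≡0 zero    p≡false = refl
all-false⇒count≡0 (suc n) p≡false rewrite p≡false zero = all-false⇒count≡0 n (p≡false ∘ suc)

true⇒0<count : ∀ {n} {p : Fin n → Bool} i → p i ≡ true → 0 < count n p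
true⇒0<count zero    pi rewrite pi = s≤s z≤n
true⇒0<count {p = p} (suc i) pi = ≤-trans (true⇒0<count i pi) (m≤n+m _ [ p zero ])

0<count⇒∃true : ∀ {n} (p : Fin n → Bool) → 0 < count n p → ∃ λ i → p i ≡ true
0<count⇒∃true {suc n} p 0<c with p zero in p0
... | true  = zero , p0
... | false = Product.map suc id (0<count⇒∃true (p ∘ suc) 0<c)

count≤1⇒unique : ∀ {n} (p : Fin n → Bool) {i j} → count n p ≤ 1 → p i ≡ true → p j ≡ true → i ≡ j
count≤1⇒unique {suc n} p {zero}  {zero}  _   _  _  = refl
count≤1⇒unique {suc n} p {zero}  {suc j} c≤1 p0 pj rewrite p0 =
  ⊥-elim (<⇒≱ (true⇒0<count j pj) (s≤s⁻¹ c≤1))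
count≤1⇒unique {suc n} p {suc i} {zero}  c≤1 pi p0 rewrite p0 =
  ⊥-elim (<⇒≱ (true⇒0<count i pi) (s≤s⁻¹ c≤1))
count≤1⇒unique {suc n} p {suc i} {suc j} c≤1 pi pj =
  cong suc (count≤1⇒unique (p ∘ suc) (m+n≤o⇒n≤o [ p zero ] c≤1) pi pj)

unique⇒count≡1 : ∀ {n} {p : Fin n → Bool} i → p i ≡ true → (∀ j → p j ≡ true → j ≡ i) → count n p ≡ 1
unique⇒count≡1 {suc n} zero    p0 only rewrite p0 =
  cong suc (all-false⇒count≡0 n (λ j → ¬-not (λ pj → 0≢1+n (sym (only (suc j) pj)))))
unique⇒count≡1 {suc n} (suc i) pi only rewrite ¬-not (λ p0 → 0≢1+n (only zero p0)) =
  unique⇒count≡1 i pi (λ j pj → Finₚ.suc-injective (only (suc j) pj))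

count-fibres : ∀ {n k} (p : Fin n → Bool) (g : Fin n → Fin k) →
  count n p ≡ ℕΣ.sum (λ r → count n (λ i → does (g i ≟ r) ∧ p i))
count-fibres {n} {k} p g = begin
  count n p                                    ≡⟨ count≡sum n p ⟩
  ℕΣ.sum (λ i → [ p i ])                       ≡⟨ ℕΣ.sum-cong-≗ fibre ⟩
  ℕΣ.sum (λ i → ℕΣ.sum (λ r → [ f i r ]))      ≡⟨ ℕΣ.∑-comm (λ i r → [ f i r ]) ⟩
  ℕΣ.sum (λ r → ℕΣ.sum (λ i → [ f i r ]))      ≡⟨ ℕΣ.sum-cong-≗ (λ r → sym (count≡sum n (λ i → f i r))) ⟩
  ℕΣ.sum (λ r → count n (λ i → f i r))         ∎
  where
  open ≡-Reasoning
  f : Fin n → Fin k → Bool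
  f i r = does (g i ≟ r) ∧ p i
  fibre : ∀ i → [ p i ] ≡ ℕΣ.sum (λ r → [ f i r ])
  fibre i with p i
  ... | false = sym (trans (sym (count≡sum k _)) (all-false⇒count≡0 k (λ r → ∧-zeroʳ (does (g i ≟ r)))))
  ... | true  = sym (trans (sym (count≡sum k _)) (unique⇒count≡1 (g i) here only))
    where
    here : does (g i ≟ g i) ∧ true ≡ true
    here rewrite dec-true (g i ≟ g i) refl = refl
    only : ∀ r → does (g i ≟ r) ∧ true ≡ true → r ≡ g i
    only r with g i ≟ r
    ... | yes gi≡r = λ _ → sym gi≡r
    ... | no  _    = λ ()

count-if : ∀ n (D a b : Fin n → Bool) →
  count n (λ i → if D i then a i else b i) + count n (λ i → D i ∧ b i)
  ≡ count n b + count n (λ i → D i ∧ a i)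
count-if n D a b = trans (count-+ _ _) (trans (ℕΣ.sum-cong-≗ pointwise) (sym (count-+ _ _)))
  where
  count-+ : ∀ p q → count n p + count n q ≡ ℕΣ.sum (λ i → [ p i ] + [ q i ])
  count-+ p q = trans (cong₂ _+_ (count≡sum n p) (count≡sum n q))
                      (sym (ℕΣ.∑-distrib-+ (λ i → [ p i ]) (λ i → [ q i ])))
  pointwise : ∀ i → [ if D i then a i else b i ] + [ D i ∧ b i ] ≡ [ b i ] + [ D i ∧ a i ]
  pointwise i with D i
  ... | true  = +-comm [ a i ] [ b i ]
  ... | false = refl

∑<count⇒∃-vanishing : ∀ {n} (a : Fin n → ℕ) (q : Fin n → Bool) →
  ℕΣ.sum a < count n q → ∃ λ r → q r ≡ true × a r ≡ 0
∑<count⇒∃-vanishing {suc n} a q lt with q zero in q0 | a zero in a0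
... | true  | zero  = zero , q0 , a0
... | true  | suc x = Product.map suc id (∑<count⇒∃-vanishing (a ∘ suc) (q ∘ suc)
                                            (≤-<-trans (m≤n+m _ x) (s<s⁻¹ lt)))
... | false | x     = Product.map suc id (∑<count⇒∃-vanishing (a ∘ suc) (q ∘ suc)
                                            (≤-<-trans (m≤n+m _ x) lt))

module _ {N : ℕ} where

  Reach : Digraph N → Fin N → Fin N → Set
  Reach X = Star (λ i j → X i j ≡ true)

  ArcClosed : Digraph N → Subset N → Set
  ArcClosed Q D = ∀ {i j} → Q i j ≡ true → D i ≡ D j

  isRoot⇒outdeg≡0 : ∀ (X : Digraph N) i → isRoot X i ≡ true → outdeg X i ≡ 0
  isRoot⇒outdeg≡0 X i with outdeg X i
  ... | zero = λ _ → refl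

  ¬isRoot⇒0<outdeg : ∀ (X : Digraph N) i → isRoot X i ≡ false → 0 < outdeg X i
  ¬isRoot⇒0<outdeg X i with outdeg X i
  ... | suc _ = λ _ → s≤s z≤n

  root⇒¬arc : ∀ (X : Digraph N) {i j} → isRoot X i ≡ true → X i j ≡ true → ⊥
  root⇒¬arc X {i} {j} root e = <⇒≢ (true⇒0<count j e) (sym (isRoot⇒outdeg≡0 X i root))

  ¬root⇒arc : ∀ (X : Digraph N) {i} → isRoot X i ≡ false → ∃ λ j → X i j ≡ true
  ¬root⇒arc X {i} ¬root = 0<count⇒∃true (X i) (¬isRoot⇒0<outdeg X i ¬root)

  forest-functional : ∀ {X : Digraph N} {i j k} → IsForest X → X i j ≡ true → X i k ≡ true → j ≡ k
  forest-functional {X} {i} (_ , outdeg≤1) eij eik = count≤1⇒unique (X i) (≤1 (outdeg≤1 i)) eij eik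
    where
    ≤1 : ∀ {d} → d ≡ 0 ⊎ d ≡ 1 → d ≤ 1
    ≤1 (inj₁ refl) = z≤n
    ≤1 (inj₂ refl) = ≤-refl

  data Path (X : Digraph N) : ℕ → Fin N → Set where
    []  : ∀ {i} → Path X 0 i
    _∷_ : ∀ {i j k} → X i j ≡ true → Path X k j → Path X (suc k) i

  vertex : ∀ {X k i} → Path X k i → Fin (suc k) → Fin N
  vertex {i = i} _ zero    = i
  vertex (_ ∷ p)  (suc t) = vertex p t

  reach-vertex : ∀ {X k i} (p : Path X k i) t → Reach X i (vertex p t)
  reach-vertex p       zero    = ε
  reach-vertex (e ∷ p) (suc t) = e ◅ reach-vertex p t

  arc◅reach⇒walk : ∀ {X : Digraph N} {i j k} → X i j ≡ true → Reach X j k → Walk X i k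
  arc◅reach⇒walk e ε        = arc e
  arc◅reach⇒walk e (e′ ◅ r) = e ∷ arc◅reach⇒walk e′ r

  walk-between : ∀ {X k i} (p : Path X k i) {s t} → s Fin.< t → Walk X (vertex p s) (vertex p t)
  walk-between (e ∷ p) {zero}  {suc t} _         = arc◅reach⇒walk e (reach-vertex p t)
  walk-between (e ∷ p) {suc s} {suc t} (s≤s s<t) = walk-between p s<t

  RootReachable : Digraph N → Fin N → Set
  RootReachable X i = ∃ λ r → Reach X i r × isRoot X r ≡ true

  root-or-path : ∀ (X : Digraph N) k i → RootReachable X i ⊎ Path X k i
  root-or-path X zero    i = inj₂ []
  root-or-path X (suc k) i with isRoot X i in root
  ... | true  = inj₁ (i , ε , root)
  ... | false with ¬root⇒arc X root
  ...   | j , e with root-or-path X k j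
  ...     | inj₁ (r , j⇝r , r-root) = inj₁ (r , e ◅ j⇝r , r-root)
  ...     | inj₂ p                   = inj₂ (e ∷ p)

  -- A path with N arcs visits N + 1 vertices, so some vertex repeats and closes a circuit.
  acyclic⇒root-reachable : ∀ {X : Digraph N} → Acyclic X → ∀ i → RootReachable X i
  acyclic⇒root-reachable {X} acyclic i with root-or-path X N i
  ... | inj₁ reachable = reachable
  ... | inj₂ p =
    let s , t , s<t , same = pigeonhole (n<1+n N) (vertex p)
    in ⊥-elim (acyclic _ (subst (Walk X (vertex p s)) (sym same) (walk-between p s<t)))

  reached-roots-equal : ∀ {X : Digraph N} {i r r′} → IsForest X → Reach X i r → Reach X i r′ →
    isRoot X r ≡ true → isRoot X r′ ≡ true → r ≡ r′
  reached-roots-equal         forest ε        ε          _    _     = refl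
  reached-roots-equal {X = X} forest ε        (e′ ◅ _)   root _     = ⊥-elim (root⇒¬arc X root e′)
  reached-roots-equal {X = X} forest (e ◅ _)  ε          _    root′ = ⊥-elim (root⇒¬arc X root′ e)
  reached-roots-equal         forest (e ◅ r)  (e′ ◅ r′)  root root′ with forest-functional forest e e′
  ... | refl = reached-roots-equal forest r r′ root root′

  module Trees {Q : Digraph N} (forest : IsForest Q) where

    root : Fin N → Fin N
    root i = proj₁ (acyclic⇒root-reachable (proj₁ forest) i)

    root-reached : ∀ i → Reach Q i (root i)
    root-reached i = proj₁ (proj₂ (acyclic⇒root-reachable (proj₁ forest) i))

    root-isRoot : ∀ i → isRoot Q (root i) ≡ true
    root-isRoot i = proj₂ (proj₂ (acyclic⇒root-reachable (proj₁ forest) i))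

    root-arc : ∀ {i j} → Q i j ≡ true → root i ≡ root j
    root-arc {i} {j} e =
      reached-roots-equal forest (root-reached i) (e ◅ root-reached j) (root-isRoot i) (root-isRoot j)

    root-of-root : ∀ {i} → isRoot Q i ≡ true → root i ≡ i
    root-of-root {i} i-root = reached-roots-equal forest (root-reached i) ε (root-isRoot i) i-root

    tree : Fin N → Subset N
    tree r i = does (root i ≟ r)

    tree-closed : ∀ r → ArcClosed Q (tree r)
    tree-closed r e = cong (λ x → does (x ≟ r)) (root-arc e)

    rootsIn-tree : ∀ {r} → isRoot Q r ≡ true → rootsIn (tree r) Q ≡ 1
    rootsIn-tree {r} r-root = unique⇒count≡1 r here only
      where
      here : tree r r ∧ isRoot Q r ≡ true
      here rewrite root-of-root r-root | dec-true (r ≟ r) refl = r-root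
      only : ∀ i → tree r i ∧ isRoot Q i ≡ true → i ≡ r
      only i with root i ≟ r | isRoot Q i in i-root
      ... | yes root-i≡r | true  = λ _ → trans (sym (root-of-root i-root)) root-i≡r
      ... | yes _        | false = λ ()
      ... | no  _        | _     = λ ()

    rootsIn-trees : ∀ R → numTrees R ≡ ℕΣ.sum (λ r → rootsIn (tree r) R)
    rootsIn-trees R = count-fibres (isRoot R) root

  -- Every root of R lies in exactly one tree of Q, so fewer roots than trees leaves a tree empty.
  ∃-tree-without-roots : ∀ {R Q : Digraph N} → IsForest Q → numTrees R < numTrees Q →
    ∃ λ D → ArcClosed Q D × rootsIn D R ≡ 0 × rootsIn D Q ≡ 1
  ∃-tree-without-roots {R} {Q} forest R<Q =
    let r , r-root , empty = ∑<count⇒∃-vanishing (λ r → rootsIn (tree r) R) (isRoot Q)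
                               (subst (_< numTrees Q) (rootsIn-trees R) R<Q)
    in tree r , tree-closed r , empty , rootsIn-tree r-root
    where open Trees forest

  walk-map : ∀ {X Y : Digraph N} → (∀ {i j} → X i j ≡ true → Y i j ≡ true) → ∀ {i j} → Walk X i j → Walk Y i j
  walk-map X⊆Y (arc e) = arc (X⊆Y e)
  walk-map X⊆Y (e ∷ p) = X⊆Y e ∷ walk-map X⊆Y p

  forest-resp : ∀ {X Y : Digraph N} → (∀ i j → X i j ≡ Y i j) → IsForest X → IsForest Y
  forest-resp X≗Y (acyclic , outdeg≤1) =
      (λ i p → acyclic i (walk-map (λ {i} {j} e → trans (X≗Y i j) e) p))
    , (λ i → subst (λ d → d ≡ 0 ⊎ d ≡ 1) (count-cong N (X≗Y i)) (outdeg≤1 i))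

  module _ {R Q : Digraph N} {D : Subset N} (closed : ArcClosed Q D) where

    walk-from-inside : ∀ {i j} → Walk (exchange R Q D) i j → D i ≡ true → Walk Q i j
    walk-from-inside (arc e) Di rewrite Di = arc e
    walk-from-inside (e ∷ p) Di rewrite Di = e ∷ walk-from-inside p (trans (sym (closed e)) Di)

    walk-into-outside : ∀ {i j} → Walk (exchange R Q D) i j → D j ≡ false → Walk R i j × D i ≡ false
    walk-into-outside {i} (arc e) Dj with D i in Di
    ... | true with () ← trans (sym Di) (trans (closed e) Dj)
    ... | false = arc e , refl
    walk-into-outside {i} (e ∷ p) Dj with walk-into-outside p Dj | D i in Di
    ... | _      , Dk | true with () ← trans (sym Di) (trans (closed e) Dk)
    ... | p-in-R , _  | false = e ∷ p-in-R , refl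

    -- A walk that enters D never leaves it, so a circuit lies entirely inside or outside D.
    exchange-acyclic : Acyclic R → Acyclic Q → Acyclic (exchange R Q D)
    exchange-acyclic acyclicR acyclicQ i p with D i in Di
    ... | true  = acyclicQ i (walk-from-inside p Di)
    ... | false = acyclicR i (proj₁ (walk-into-outside p Di))

    exchange-forest : IsForest R → IsForest Q → IsForest (exchange R Q D)
    exchange-forest (acyclicR , outdegR) (acyclicQ , outdegQ) = exchange-acyclic acyclicR acyclicQ , outdeg≤1
      where
      outdeg≤1 : ∀ i → outdeg (exchange R Q D) i ≡ 0 ⊎ outdeg (exchange R Q D) i ≡ 1
      outdeg≤1 i with D i
      ... | true  = outdegQ i
      ... | false = outdegR i

  exchange-flip : ∀ (A B : Digraph N) D i j → exchange A B (not ∘ D) i j ≡ exchange B A D i j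
  exchange-flip A B D i j with D i
  ... | true  = refl
  ... | false = refl

  exchange-forest′ : ∀ {R Q : Digraph N} {D} → ArcClosed Q D → IsForest R → IsForest Q → IsForest (exchange Q R D)
  exchange-forest′ {R} {Q} {D} closed forestR forestQ =
    forest-resp (exchange-flip R Q D) (exchange-forest (cong not ∘ closed) forestR forestQ)

  exchange-⊆ᴬ : ∀ {V A B : Digraph N} {D} → A ⊆ᴬ V → B ⊆ᴬ V → exchange A B D ⊆ᴬ V
  exchange-⊆ᴬ {D = D} A⊆V B⊆V i j with D i
  ... | true  = B⊆V i j
  ... | false = A⊆V i j

  numTrees-exchange : ∀ (A B : Digraph N) D → numTrees (exchange A B D) + rootsIn D A ≡ numTrees A + rootsIn D B
  numTrees-exchange A B D =
    trans (cong (_+ rootsIn D A) (count-cong N isRoot-exchange)) (count-if N D (isRoot B) (isRoot A))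
    where
    isRoot-exchange : ∀ i → isRoot (exchange A B D) i ≡ (if D i then isRoot B i else isRoot A i)
    isRoot-exchange i with D i
    ... | true  = refl
    ... | false = refl

  numTrees-exchange-pair : ∀ (A B : Digraph N) D →
    numTrees (exchange A B D) + numTrees (exchange B A D) ≡ numTrees A + numTrees B
  numTrees-exchange-pair A B D = +-cancelʳ-≡ (rootsIn D A + rootsIn D B) _ _ (begin
    (numTrees (exchange A B D) + numTrees (exchange B A D)) + (rootsIn D A + rootsIn D B)
      ≡⟨ +-interchange (numTrees (exchange A B D)) _ (rootsIn D A) _ ⟩
    (numTrees (exchange A B D) + rootsIn D A) + (numTrees (exchange B A D) + rootsIn D B)
      ≡⟨ cong₂ _+_ (numTrees-exchange A B D) (numTrees-exchange B A D) ⟩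
    (numTrees A + rootsIn D B) + (numTrees B + rootsIn D A)
      ≡⟨ +-interchange (numTrees A) _ (numTrees B) _ ⟩
    (numTrees A + numTrees B) + (rootsIn D B + rootsIn D A)
      ≡⟨ cong (numTrees A + numTrees B +_) (+-comm (rootsIn D B) (rootsIn D A)) ⟩
    (numTrees A + numTrees B) + (rootsIn D A + rootsIn D B)
      ∎)
    where open ≡-Reasoning

  numTrees-exchange-gains : ∀ (A B : Digraph N) D {l} →
    rootsIn D B ≡ rootsIn D A + l → numTrees (exchange A B D) ≡ numTrees A + l
  numTrees-exchange-gains A B D {l} B≡A+l = +-cancelʳ-≡ (rootsIn D A) _ _ (begin
    numTrees (exchange A B D) + rootsIn D A  ≡⟨ numTrees-exchange A B D ⟩
    numTrees A + rootsIn D B                 ≡⟨ cong (numTrees A +_) (trans B≡A+l (+-comm (rootsIn D A) l)) ⟩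
    numTrees A + (l + rootsIn D A)           ≡⟨ +-assoc (numTrees A) l (rootsIn D A) ⟨
    numTrees A + l + rootsIn D A             ∎)
    where open ≡-Reasoning

  numTrees-exchange-loses : ∀ (A B : Digraph N) D {l} →
    rootsIn D A ≡ rootsIn D B + l → numTrees (exchange A B D) + l ≡ numTrees A
  numTrees-exchange-loses A B D {l} A≡B+l = +-cancelʳ-≡ (rootsIn D B) _ _ (begin
    numTrees P + l + rootsIn D B    ≡⟨ +-assoc (numTrees P) l (rootsIn D B) ⟩
    numTrees P + (l + rootsIn D B)  ≡⟨ cong (numTrees P +_) (trans (+-comm l (rootsIn D B)) (sym A≡B+l)) ⟩
    numTrees P + rootsIn D A        ≡⟨ numTrees-exchange A B D ⟩
    numTrees A + rootsIn D B        ∎)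
    where
    open ≡-Reasoning
    P = exchange A B D

  -- Exchanging a tree of Q that contains no root of R moves exactly one tree from Q to R.
  exchange-step : ∀ {V R Q : Digraph N} {a b} → InForests V a R → InForests V (suc b) Q → a ≤ b →
    ∃ λ D → InForests V (suc a) (exchange R Q D) × InForests V b (exchange Q R D)
  exchange-step {V} {R} {Q} (R⊆V , forestR , refl) (Q⊆V , forestQ , treesQ) a≤b =
    let D , closed , noRootR , oneRootQ =
          ∃-tree-without-roots forestQ (subst (numTrees R <_) (sym treesQ) (s≤s a≤b))
        Q≡R+1 = trans oneRootQ (cong (_+ 1) (sym noRootR))
    in D , (exchange-⊆ᴬ R⊆V Q⊆V , exchange-forest closed forestR forestQ ,
            trans (numTrees-exchange-gains R Q D Q≡R+1) (+-comm (numTrees R) 1))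
         , (exchange-⊆ᴬ Q⊆V R⊆V , exchange-forest′ closed forestR forestQ ,
            suc-injective (trans (+-comm 1 _) (trans (numTrees-exchange-loses Q R D Q≡R+1) treesQ)))

sumFin≡foldr : ∀ {a} {A : Set a} (_+′_ : A → A → A) (0′ : A) n (f : Fin n → A) →
  sumFin _+′_ 0′ n f ≡ Vector.foldr _+′_ 0′ f
sumFin≡foldr _+′_ 0′ zero    f = refl
sumFin≡foldr _+′_ 0′ (suc n) f = cong (f zero +′_) (sumFin≡foldr _+′_ 0′ n (f ∘ suc))

module OrderedAbelianGroupProperties {c ℓ₁ ℓ₂} (W : OrderedAbelianGroup c ℓ₁ ℓ₂) where
  open OrderedAbelianGroup W using (_∙_; _⁻¹; comm; group; isTotalOrder; ∙-monoˡ-≤)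
    renaming (_≤_ to _≼_)
  open IsTotalOrder isTotalOrder using (≲-respˡ-≈; ≲-respʳ-≈) renaming (trans to ≼-trans)
  open GroupProperties group using (//-rightDividesʳ)

  ∙-monoʳ-≼ : ∀ z {x y} → x ≼ y → (z ∙ x) ≼ (z ∙ y)
  ∙-monoʳ-≼ z {x} {y} x≼y = ≲-respʳ-≈ (comm y z) (≲-respˡ-≈ (comm x z) (∙-monoˡ-≤ z x≼y))

  ∙-mono-≼ : ∀ {x y u v} → x ≼ y → u ≼ v → (x ∙ u) ≼ (y ∙ v)
  ∙-mono-≼ {y = y} {u} x≼y u≼v = ≼-trans (∙-monoˡ-≤ u x≼y) (∙-monoʳ-≼ y u≼v)

  ∙-cancelʳ-≼ : ∀ z {x y} → (x ∙ z) ≼ (y ∙ z) → x ≼ y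
  ∙-cancelʳ-≼ z {x} {y} h =
    ≲-respʳ-≈ (//-rightDividesʳ z y) (≲-respˡ-≈ (//-rightDividesʳ z x) (∙-monoˡ-≤ (z ⁻¹) h))

  ∙-cancelˡ-≼ : ∀ z {x y} → (z ∙ x) ≼ (z ∙ y) → x ≼ y
  ∙-cancelˡ-≼ z {x} {y} h = ∙-cancelʳ-≼ z (≲-respʳ-≈ (comm z y) (≲-respˡ-≈ (comm z x) h))

module Weights {c ℓ₁ ℓ₂} (W : OrderedAbelianGroup c ℓ₁ ℓ₂) {N : ℕ}
               (v : Fin N → Fin N → OrderedAbelianGroup.Carrier W) where
  open OrderedAbelianGroup W using (Carrier; _≈_; _∙_; comm; setoid; commutativeMonoid)
    renaming (ε to 0#; refl to ≈-refl)
  open CommutativeMonoidSum commutativeMonoid using (sum; sum-cong-≋; ∑-distrib-+)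

  row : Digraph N → Fin N → Carrier
  row X i = sumFin _∙_ 0# N (λ j → if X i j then v i j else 0#)

  weight-exchange : ∀ (A B : Digraph N) D →
    (weight W v (exchange A B D) ∙ weight W v (exchange B A D)) ≈ (weight W v A ∙ weight W v B)
  weight-exchange A B D = begin
    weight W v P ∙ weight W v Q      ≡⟨ cong₂ _∙_ (as-sum P) (as-sum Q) ⟩
    sum (row P) ∙ sum (row Q)        ≈⟨ ∑-distrib-+ (row P) (row Q) ⟨
    sum (λ i → row P i ∙ row Q i)    ≈⟨ sum-cong-≋ rows ⟩
    sum (λ i → row A i ∙ row B i)    ≈⟨ ∑-distrib-+ (row A) (row B) ⟩
    sum (row A) ∙ sum (row B)        ≡⟨ cong₂ _∙_ (as-sum A) (as-sum B) ⟨
    weight W v A ∙ weight W v B      ∎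
    where
    open import Relation.Binary.Reasoning.Setoid setoid
    as-sum : ∀ X → weight W v X ≡ sum (row X)
    as-sum X = sumFin≡foldr _∙_ 0# N (row X)
    P = exchange A B D
    Q = exchange B A D
    rows : ∀ i → (row P i ∙ row Q i) ≈ (row A i ∙ row B i)
    rows i with D i
    ... | true  = comm (row B i) (row A i)
    ... | false = ≈-refl

module Minimality {c ℓ₁ ℓ₂} (W : OrderedAbelianGroup c ℓ₁ ℓ₂) {N : ℕ} (V : Digraph N)
                  (v : Fin N → Fin N → OrderedAbelianGroup.Carrier W) where
  open OrderedAbelianGroup W using (Carrier; _≈_; _∙_; comm; isTotalOrder)
    renaming (_≤_ to _≼_; refl to ≈-refl; sym to ≈-sym; trans to ≈-trans)
  open IsTotalOrder isTotalOrder using (≲-respˡ-≈; ≲-respʳ-≈)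
  open OrderedAbelianGroupProperties W
  open Weights W v using (weight-exchange)

  w : Digraph N → Carrier
  w = weight W v

  InMin : ℕ → Digraph N → Set ℓ₂
  InMin = InMinForests W V v

  rebalance : ∀ d {a b S T} → d + a ≤ b → InForests V a S → InForests V (d + b) T →
    ∃₂ λ S′ T′ → InForests V (d + a) S′ × InForests V b T′ × (w S′ ∙ w T′) ≈ (w S ∙ w T)
  rebalance zero    {S = S} {T} _ S∈ T∈ = S , T , S∈ , T∈ , ≈-refl
  rebalance (suc d) {a} {b} {S} {T} d+a<b S∈ T∈ =
    let D , S₁∈ , T₁∈ = exchange-step S∈ T∈ (≤-trans (m+n≤o⇒n≤o (suc d) d+a<b) (m≤n+m b d))
        S′ , T′ , S′∈ , T′∈ , same = rebalance d (subst (_≤ b) (sym (+-suc d a)) d+a<b) S₁∈ T₁∈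
    in S′ , T′ , subst (λ k → InForests V k S′) (+-suc d a) S′∈ , T′∈
     , ≈-trans same (weight-exchange S T D)

  minimal-pair-≼ : ∀ {n m a b F G S T} → InMin n F → InMin m G → n ≤ m →
    InForests V a S → InForests V b T → a ≤ n → a + b ≡ n + m → (w F ∙ w G) ≼ (w S ∙ w T)
  minimal-pair-≼ {m = m} {a} {b} (_ , F-least) (_ , G-least) n≤m S∈ T∈ a≤n a+b≡n+m
    with d , refl ← m≤n⇒∃[o]m+o≡n a≤n
    with refl ← +-cancelˡ-≡ a b (d + m) (trans a+b≡n+m (+-assoc a d m)) =
    let S′ , T′ , S′∈ , T′∈ , same = rebalance d (subst (_≤ m) (+-comm a d) n≤m) S∈ T∈
    in ≲-respʳ-≈ same (∙-mono-≼ (F-least S′ (subst (λ k → InForests V k S′) (+-comm d a) S′∈))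
                                (G-least T′ T′∈))

  same-weight⇒minimal : ∀ {n m a b F G X Y} → InMin n F → InMin m G → n ≤ m →
    InForests V a X → InForests V b Y → a ≤ n → a + b ≡ n + m → (w X ∙ w Y) ≈ (w F ∙ w G) →
    InMin a X × InMin b Y
  same-weight⇒minimal {F = F} {G} {X} {Y} F-min G-min n≤m X∈ Y∈ a≤n a+b≡n+m same =
      (X∈ , λ S S∈ → ∙-cancelʳ-≼ (w Y) (below (minimal-pair-≼ F-min G-min n≤m S∈ Y∈ a≤n a+b≡n+m)))
    , (Y∈ , λ T T∈ → ∙-cancelˡ-≼ (w X) (below (minimal-pair-≼ F-min G-min n≤m X∈ T∈ a≤n a+b≡n+m)))
    where
    below : ∀ {z} → (w F ∙ w G) ≼ z → (w X ∙ w Y) ≼ z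
    below = ≲-respˡ-≈ (≈-sym same)

  exchange-minimal : ∀ {n m F G D} → InMin n F → InMin m G → n ≤ m →
    IsForest (exchange F G D) → IsForest (exchange G F D) →
    numTrees (exchange F G D) ≤ n ⊎ numTrees (exchange G F D) ≤ n →
    InMin (numTrees (exchange F G D)) (exchange F G D) × InMin (numTrees (exchange G F D)) (exchange G F D)
  exchange-minimal {F = F} {G} {D} F-min@((F⊆V , _ , refl) , _) G-min@((G⊆V , _ , refl) , _) n≤m
                   P-forest Q-forest =
    Sum.[ (λ P≤n → same-weight⇒minimal F-min G-min n≤m P∈ Q∈ P≤n trees (weight-exchange F G D))
        , (λ Q≤n → swap (same-weight⇒minimal F-min G-min n≤m Q∈ P∈ Q≤n
                           (trans (+-comm (numTrees (exchange G F D)) _) trees)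
                           (≈-trans (comm _ _) (weight-exchange F G D))))
        ]
    where
    P∈ : InForests V (numTrees (exchange F G D)) (exchange F G D)
    P∈ = exchange-⊆ᴬ F⊆V G⊆V , P-forest , refl
    Q∈ : InForests V (numTrees (exchange G F D)) (exchange G F D)
    Q∈ = exchange-⊆ᴬ G⊆V F⊆V , Q-forest , refl
    trees : numTrees (exchange F G D) + numTrees (exchange G F D) ≡ numTrees F + numTrees G
    trees = numTrees-exchange-pair F G D

m+n≡o⇒n≤o×m≡o∸n : ∀ {m n o} → m + n ≡ o → n ≤ o × m ≡ o ∸ n
m+n≡o⇒n≤o×m≡o∸n {m} {n} refl = m≤n+m n m , sym (m+n∸n≡m m n)

proposition3 : ∀ {c ℓ₁ ℓ₂} (W : OrderedAbelianGroup c ℓ₁ ℓ₂) (N : ℕ)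
    (V : Digraph N) (v : Fin N → Fin N → OrderedAbelianGroup.Carrier W)
    (n m : ℕ) (F G : Digraph N) (D : Subset N) →
    InMinForests W V v n F → InMinForests W V v m G → n ≤ m →
    IsForest (exchange F G D) → IsForest (exchange G F D) →
    (∀ (l : ℕ) → rootsIn D F ≡ rootsIn D G + l →
       l ≤ n × InMinForests W V v (n ∸ l) (exchange F G D)
             × InMinForests W V v (m + l) (exchange G F D))
    × (∀ (l : ℕ) → rootsIn D G ≡ rootsIn D F + l → m ∸ n ≤ l →
       l ≤ m × InMinForests W V v (n + l) (exchange F G D)
             × InMinForests W V v (m ∸ l) (exchange G F D))
proposition3 W N V v n m F G D F-min@((_ , _ , refl) , _) G-min@((_ , _ , refl) , _) n≤m P-forest Q-forest =
  part-a , part-b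
  where
  open Minimality W V v using (InMin; exchange-minimal)
  P = exchange F G D
  Q = exchange G F D
  resize : ∀ {k k′ X} → k ≡ k′ → InMin k X → InMin k′ X
  resize {X = X} = subst (λ k → InMin k X)

  part-a : ∀ l → rootsIn D F ≡ rootsIn D G + l → l ≤ n × InMin (n ∸ l) P × InMin (m + l) Q
  part-a l F≡G+l =
    let P+l≡n = numTrees-exchange-loses F G D F≡G+l
        l≤n , P≡n∸l = m+n≡o⇒n≤o×m≡o∸n P+l≡n
        P≤n = subst (numTrees P ≤_) P+l≡n (m≤m+n _ l)
        P-min , Q-min = exchange-minimal F-min G-min n≤m P-forest Q-forest (inj₁ P≤n)
    in l≤n , resize P≡n∸l P-min , resize (numTrees-exchange-gains G F D F≡G+l) Q-min

  part-b : ∀ l → rootsIn D G ≡ rootsIn D F + l → m ∸ n ≤ l → l ≤ m × InMin (n + l) P × InMin (m ∸ l) Q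
  part-b l G≡F+l m∸n≤l =
    let Q+l≡m = numTrees-exchange-loses G F D G≡F+l
        l≤m , Q≡m∸l = m+n≡o⇒n≤o×m≡o∸n Q+l≡m
        m≤n+l = ≤-trans (m≤n+m∸n m n) (+-monoʳ-≤ n m∸n≤l)
        Q≤n = +-cancelʳ-≤ l _ n (subst (_≤ n + l) (sym Q+l≡m) m≤n+l)
        P-min , Q-min = exchange-minimal F-min G-min n≤m P-forest Q-forest (inj₂ Q≤n)
    in l≤m , resize (numTrees-exchange-gains F G D G≡F+l) P-min , resize Q≡m∸l Q-min
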